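{- Let $G_1=(V_1,E_1)$ and $G_2=(V_2,E_2)$ be finite graphs and let $G=G_1+G_2$ be their join. For $i=1,2$ let $\varphi_i:V_i\to V_i$ be an automorphism of $G_i$ such that (a) $\varphi_i\circ\varphi_i=\mathrm{id}_{V_i}$ and (b) $\{u,\varphi_i(u)\}\notin E_i$ for all $u\in V_i$. Let $H_i$ be the induced subgraph of $G_i$ on the fixed points $\{u\in V_i : \varphi_i(u)=u\}$. Then ${\rm Nim}(G)={\rm Nim}(H_1+H_2)$.
   Context: Chomp on a finite poset $P$ with global minimum $0$: two players alternately pick an element $x$ of the remaining poset and remove all elements $\ge x$; the player forced to pick $0$ loses. ${\rm Nim}(\{0\})=0$ and ${\rm Nim}(P)=\mathrm{mex}\{{\rm Nim}(P_x) : x\in P\setminus\{0\}\}$, where $P_x$ is $P$ with the up-set of $x$ removed. A finite graph is regarded as the poset of the empty set, its vertices and its edges ordered by inclusion (a move removes an edge or a vertex with its incident edges). The join $G_1+G_2$ of graphs on disjoint vertex sets has vertex set $V_1\cup V_2$ and edge set $E_1\cup E_2\cup\{\{u,v\}: u\in V_1, v\in V_2\}$. -}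

module Defs where

open import Data.Bool using (Bool; true; false; not; _∧_; _∨_; if_then_else_)
open import Data.Nat using (ℕ; zero; suc)
open import Data.List using (List; []; _∷_; map; _++_; filter; filterᵇ; length)
open import Data.List.Membership.Propositional using (_∈_)
open import Data.List.Membership.Propositional.Properties using (∈-map⁻)
open import Data.List.Relation.Unary.Unique.Propositional using (Unique)
import Data.List.Relation.Unary.Unique.Propositional.Properties as UP
open import Data.Product using (Σ; _×_; _,_; proj₁; proj₂)
open import Data.Sum using (_⊎_; inj₁; inj₂)
open import Data.Sum.Properties using (≡-dec; inj₁-injective; inj₂-injective)
open import Relation.Binary.PropositionalEquality using (_≡_; refl; sym; trans)
open import Relation.Binary.Definitions using (DecidableEquality)
open import Relation.Nullary using (does; ¬_)
open import Data.Empty using (⊥)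
open import Data.Bool.ListAction using (any)

-- The vertex set is the finite set of elements of the duplicate-free list
-- 'verts'; adjacency is a symmetric irreflexive Boolean relation (only its
-- values on 'verts' matter).

record Graph : Set₁ where
  field
    V       : Set
    decEq   : DecidableEquality V
    verts   : List V
    uniq    : Unique verts
    adj     : V → V → Bool
    adj-sym : ∀ u v → adj u v ≡ adj v u
    adj-irr : ∀ u → adj u u ≡ false
open Graph public

-- The poset of a graph: the empty set, the vertices and the edges,
-- ordered by inclusion.

data PElem (V : Set) : Set where
  ∅  : PElem V
  vx : V → PElem V
  ed : V → V → PElem V

module _ {V : Set} (_≟_ : DecidableEquality V) where

  eqᵇ : V → V → Bool
  eqᵇ u v = does (u ≟ v)

  leqᵇ : PElem V → PElem V → Bool
  leqᵇ ∅        _        = true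
  leqᵇ (vx u)   ∅        = false
  leqᵇ (vx u)   (vx v)   = eqᵇ u v
  leqᵇ (vx u)   (ed a b) = eqᵇ u a ∨ eqᵇ u b
  leqᵇ (ed a b) ∅        = false
  leqᵇ (ed a b) (vx v)   = false
  leqᵇ (ed a b) (ed c d) =
    (eqᵇ a c ∧ eqᵇ b d) ∨ (eqᵇ a d ∧ eqᵇ b c)

pairs : {V : Set} → List V → List (V × V)
pairs []       = []
pairs (x ∷ xs) = map (λ y → x , y) xs ++ pairs xs

edges : (G : Graph) → List (V G × V G)
edges G = filterᵇ (λ p → adj G (proj₁ p) (proj₂ p)) (pairs (verts G))

elems : (G : Graph) → List (PElem (V G))
elems G = ∅ ∷ (map vx (verts G) ++ map (λ p → ed (proj₁ p) (proj₂ p)) (edges G))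

member : ℕ → List ℕ → Bool
member k = any (λ m → does (k Data.Nat.≟ m))

-- least k ≥ start not in l (fuel = length l suffices from start = 0)
mexFrom : ℕ → ℕ → List ℕ → ℕ
mexFrom zero     k l = k
mexFrom (suc f)  k l = if member k l then mexFrom f (suc k) l else k

mex : List ℕ → ℕ
mex l = mexFrom (length l) zero l

isBot : {V : Set} → PElem V → Bool
isBot ∅ = true
isBot _ = false

-- Nim value of the Chomp position P (a down-closed set of poset elements,
-- listed), computed with fuel.  Every move removes at least the chosen
-- element, and ∅ is never removed, so fuel ≥ length P never runs out.
nimP : {V : Set} → DecidableEquality V → ℕ → List (PElem V) → ℕ
nimP _≟_ zero    P = zero
nimP _≟_ (suc f) P =
  mex (map (λ x → nimP _≟_ f (filterᵇ (λ y → not (leqᵇ _≟_ x y)) P))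
           (filterᵇ (λ x → not (isBot x)) P))

Nim : Graph → ℕ
Nim G = nimP (decEq G) (suc (length (elems G))) (elems G)

joinAdj : {A B : Set} → (A → A → Bool) → (B → B → Bool) → A ⊎ B → A ⊎ B → Bool
joinAdj a b (inj₁ x) (inj₁ y) = a x y
joinAdj a b (inj₁ x) (inj₂ y) = true
joinAdj a b (inj₂ x) (inj₁ y) = true
joinAdj a b (inj₂ x) (inj₂ y) = b x y

private
  disj : {A B : Set} (xs : List A) (ys : List B) {v : A ⊎ B} →
         v ∈ map inj₁ xs × v ∈ map inj₂ ys → ⊥
  disj xs ys (p , q) with ∈-map⁻ inj₁ p | ∈-map⁻ inj₂ q
  ... | _ , _ , refl | _ , _ , ()


_+ᴳ_ : Graph → Graph → Graph
G₁ +ᴳ G₂ = record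
  { V       = V G₁ ⊎ V G₂
  ; decEq   = ≡-dec (decEq G₁) (decEq G₂)
  ; verts   = map inj₁ (verts G₁) ++ map inj₂ (verts G₂)
  ; uniq    = UP.++⁺ (UP.map⁺ inj₁-injective (uniq G₁))
                     (UP.map⁺ inj₂-injective (uniq G₂))
                     (disj (verts G₁) (verts G₂))
  ; adj     = joinAdj (adj G₁) (adj G₂)
  ; adj-sym = s
  ; adj-irr = r
  }
  where
  s : ∀ u v → joinAdj (adj G₁) (adj G₂) u v ≡ joinAdj (adj G₁) (adj G₂) v u
  s (inj₁ x) (inj₁ y) = adj-sym G₁ x y
  s (inj₁ x) (inj₂ y) = refl
  s (inj₂ x) (inj₁ y) = refl
  s (inj₂ x) (inj₂ y) = adj-sym G₂ x y
  r : ∀ u → joinAdj (adj G₁) (adj G₂) u u ≡ false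
  r (inj₁ x) = adj-irr G₁ x
  r (inj₂ x) = adj-irr G₂ x

record IsAutomorphism (G : Graph) (φ : V G → V G) : Set where
  field
    maps-into  : ∀ u → u ∈ verts G → φ u ∈ verts G
    injective  : ∀ u v → u ∈ verts G → v ∈ verts G → φ u ≡ φ v → u ≡ v
    surjective : ∀ v → v ∈ verts G → Σ (V G) λ u → u ∈ verts G × φ u ≡ v
    preserves  : ∀ u v → u ∈ verts G → v ∈ verts G →
                 adj G (φ u) (φ v) ≡ adj G u v

induced : (G : Graph) → (V G → Bool) → Graph
induced G p = record
  { V = V G ; decEq = decEq G
  ; verts = filterᵇ p (verts G)
  ; uniq = UP.filter⁺ _ (uniq G)
  ; adj = adj G ; adj-sym = adj-sym G ; adj-irr = adj-irr G }

fixedSubgraph : (G : Graph) → (V G → V G) → Graph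
fixedSubgraph G φ = induced G (λ u → eqᵇ (decEq G) (φ u) u)

module Submission where

-- The map φ₁ ⊎ φ₂ is an involutive automorphism of G₁ + G₂ with u ≁ φ u, so it induces an
-- involution σ of the poset of G₁ + G₂ with x ⋢ σ x whenever σ x ≠ x; its fixed elements form a
-- down-set, namely the poset of H₁ + H₂. For any σ-symmetric Chomp position Q, Nim Q equals the
-- Nim value of its fixed part R: a fixed move keeps the position symmetric and commutes with
-- passing to the fixed part, while a non-fixed move x can be answered by σ x, which is still
-- available and leads to a symmetric position whose fixed part is again R. By induction that
-- answer has value Nim R, so no non-fixed move has value Nim R, and the two mex computations agree.

open import Defs
open import Data.Bool using (Bool; true; false; not; _∧_; _∨_; T)
open import Data.Bool.Properties using (T-≡; ¬-not; not-injective; ∧-conicalˡ; ∧-conicalʳ; ∧-comm)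
open import Data.Empty using (⊥-elim)
open import Data.Unit using (⊤; tt)
open import Data.List using (List; []; _∷_; map; _++_; filterᵇ; length)
open import Data.List.Properties using (map-cong-local; filter-notAll; filter-all; filter-none; filter-++; filter-idem)
open import Data.List.Membership.Propositional using (_∈_; _∉_)
open import Data.List.Membership.Propositional.Properties
  using (∈-filter⁺; ∈-filter⁻; ∈-map⁺; ∈-map⁻; ∈-++⁺ˡ; ∈-++⁺ʳ; ∈-++⁻)
open import Data.List.Relation.Binary.Subset.Propositional using (_⊆_)
open import Data.List.Relation.Unary.Any using (here; there)
import Data.List.Relation.Unary.Any as Any
import Data.List.Relation.Unary.All as All
open import Data.List.Relation.Unary.Any.Properties using (any⁺; any⁻)
open import Data.Nat using (ℕ; zero; suc; _+_; _≤_; _<_; z≤n; s≤s)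
import Data.Nat as ℕ
open import Data.Nat.Properties
  using (≡ᵇ⇒≡; ≡⇒≡ᵇ; <-trans; <-≤-trans; <-irrefl; <-cmp; n<1+n; m≤n⇒m≤1+n; m≤n⇒m<n∨m≡n; +-identityʳ; +-suc)
open import Data.Product using (Σ; _×_; _,_; proj₁; proj₂)
import Data.Product as Prod
open import Data.Sum using (_⊎_; inj₁; inj₂)
import Data.Sum
open import Data.Sum.Properties using (inj₁-injective; inj₂-injective)
open import Function using (_∘_; id; Equivalence)
open import Relation.Binary.Definitions using (DecidableEquality; tri<; tri≈; tri>)
open import Relation.Binary.PropositionalEquality
  using (_≡_; _≢_; refl; sym; trans; cong; cong₂; subst; module ≡-Reasoning)
open import Relation.Nullary using (does; yes; no; ¬_)
open import Relation.Nullary.Decidable using (T?; dec-true; dec-false)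

true≢false : true ≢ false
true≢false ()

module _ {A : Set} (p : A → Bool) where

  ∈-filterᵇ⁻ : ∀ {x xs} → x ∈ filterᵇ p xs → x ∈ xs × p x ≡ true
  ∈-filterᵇ⁻ = Prod.map₂ (Equivalence.to T-≡) ∘ ∈-filter⁻ (T? ∘ p)

  ∈-filterᵇ⁺ : ∀ {x xs} → x ∈ xs → p x ≡ true → x ∈ filterᵇ p xs
  ∈-filterᵇ⁺ x∈xs px = ∈-filter⁺ (T? ∘ p) x∈xs (Equivalence.from T-≡ px)

  length-filterᵇ-< : ∀ {x xs} → x ∈ xs → p x ≡ false → length (filterᵇ p xs) < length xs
  length-filterᵇ-< {xs = xs} x∈xs px =
    filter-notAll (T? ∘ p) xs (Any.map (λ { refl → subst T px }) x∈xs)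

  filterᵇ-all : ∀ {xs} → (∀ {x} → x ∈ xs → p x ≡ true) → filterᵇ p xs ≡ xs
  filterᵇ-all h = filter-all (T? ∘ p) (All.tabulate (Equivalence.from T-≡ ∘ h))

  filterᵇ-none : ∀ {xs} → (∀ {x} → x ∈ xs → p x ≡ false) → filterᵇ p xs ≡ []
  filterᵇ-none h = filter-none (T? ∘ p) (All.tabulate (λ x∈xs → subst T (h x∈xs)))

  filterᵇ-++ : ∀ xs ys → filterᵇ p (xs ++ ys) ≡ filterᵇ p xs ++ filterᵇ p ys
  filterᵇ-++ = filter-++ (T? ∘ p)

  filterᵇ-comm : ∀ q xs → filterᵇ p (filterᵇ q xs) ≡ filterᵇ q (filterᵇ p xs)
  filterᵇ-comm q [] = refl
  filterᵇ-comm q (x ∷ xs) with q x in qx | p x in px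
  ... | true  | true  rewrite qx | px = cong (x ∷_) (filterᵇ-comm q xs)
  ... | true  | false rewrite px = filterᵇ-comm q xs
  ... | false | true  rewrite qx = filterᵇ-comm q xs
  ... | false | false = filterᵇ-comm q xs

  filterᵇ-cong : ∀ {q} → (∀ x → p x ≡ q x) → ∀ xs → filterᵇ p xs ≡ filterᵇ q xs
  filterᵇ-cong p≗q [] = refl
  filterᵇ-cong {q} p≗q (x ∷ xs) with p x | q x | p≗q x
  ... | true  | .true  | refl = cong (x ∷_) (filterᵇ-cong p≗q xs)
  ... | false | .false | refl = filterᵇ-cong p≗q xs

  filterᵇ-map : ∀ {B : Set} (f : B → A) xs → filterᵇ p (map f xs) ≡ map f (filterᵇ (p ∘ f) xs)
  filterᵇ-map f [] = refl
  filterᵇ-map f (x ∷ xs) with p (f x)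
  ... | true  = cong (f x ∷_) (filterᵇ-map f xs)
  ... | false = filterᵇ-map f xs

module _ {A : Set} where

  ∈-pairs⁻ : ∀ xs {a b : A} → (a , b) ∈ pairs xs → a ∈ xs × b ∈ xs
  ∈-pairs⁻ (x ∷ xs) ab∈ with ∈-++⁻ (map (x ,_) xs) ab∈
  ... | inj₁ ab∈xxs with ∈-map⁻ (x ,_) ab∈xxs
  ...   | _ , b∈xs , refl = here refl , there b∈xs
  ∈-pairs⁻ (x ∷ xs) ab∈ | inj₂ ab∈pxs = Prod.map there there (∈-pairs⁻ xs ab∈pxs)

  ∈-pairs⁺ : ∀ xs {a b : A} → a ∈ xs → b ∈ xs → a ≢ b → (a , b) ∈ pairs xs ⊎ (b , a) ∈ pairs xs
  ∈-pairs⁺ (x ∷ xs) (here refl) (here refl) a≢b = ⊥-elim (a≢b refl)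
  ∈-pairs⁺ (x ∷ xs) (here refl) (there b∈)  _   = inj₁ (∈-++⁺ˡ (∈-map⁺ (x ,_) b∈))
  ∈-pairs⁺ (x ∷ xs) (there a∈)  (here refl) _   = inj₂ (∈-++⁺ˡ (∈-map⁺ (x ,_) a∈))
  ∈-pairs⁺ (x ∷ xs) (there a∈)  (there b∈)  a≢b =
    Data.Sum.map (∈-++⁺ʳ (map (x ,_) xs)) (∈-++⁺ʳ (map (x ,_) xs)) (∈-pairs⁺ xs a∈ b∈ a≢b)

  pairs-filterᵇ : ∀ (p : A → Bool) xs →
                  pairs (filterᵇ p xs) ≡ filterᵇ (λ q → p (proj₁ q) ∧ p (proj₂ q)) (pairs xs)
  pairs-filterᵇ p [] = refl
  pairs-filterᵇ p (x ∷ xs) = begin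
    pairs (filterᵇ p (x ∷ xs))
      ≡⟨ leading ⟩
    map (x ,_) (filterᵇ (λ y → p x ∧ p y) xs) ++ pairs (filterᵇ p xs)
      ≡⟨ cong₂ _++_ (sym (filterᵇ-map both (x ,_) xs)) (pairs-filterᵇ p xs) ⟩
    filterᵇ both (map (x ,_) xs) ++ filterᵇ both (pairs xs)
      ≡⟨ sym (filterᵇ-++ both (map (x ,_) xs) (pairs xs)) ⟩
    filterᵇ both (pairs (x ∷ xs))
      ∎
    where
    open ≡-Reasoning
    both : A × A → Bool
    both q = p (proj₁ q) ∧ p (proj₂ q)
    leading : pairs (filterᵇ p (x ∷ xs)) ≡ map (x ,_) (filterᵇ (λ y → p x ∧ p y) xs) ++ pairs (filterᵇ p xs)
    leading with p x
    ... | true  = refl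
    ... | false = cong (λ l → map (x ,_) l ++ pairs (filterᵇ p xs))
                       (sym (filterᵇ-none (λ _ → false) {xs} λ _ → refl))

member⇒∈ : ∀ {k} l → member k l ≡ true → k ∈ l
member⇒∈ l e = Any.map (≡ᵇ⇒≡ _ _) (any⁻ _ l (Equivalence.from T-≡ e))

∈⇒member : ∀ {k l} → k ∈ l → member k l ≡ true
∈⇒member k∈l = Equivalence.to T-≡ (any⁺ _ (Any.map (≡⇒≡ᵇ _ _) k∈l))

all-below∈⇒≤length : ∀ n l → (∀ {k} → k < n → k ∈ l) → n ≤ length l
all-below∈⇒≤length zero    l below = z≤n
all-below∈⇒≤length (suc n) l below =
  <-≤-trans (s≤s (all-below∈⇒≤length n (filterᵇ ≢n l) below′))
            (length-filterᵇ-< ≢n (below (n<1+n n)) (cong not (dec-true (n ℕ.≟ n) refl)))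
  where
  ≢n : ℕ → Bool
  ≢n m = not (does (m ℕ.≟ n))
  below′ : ∀ {k} → k < n → k ∈ filterᵇ ≢n l
  below′ {k} k<n = ∈-filterᵇ⁺ ≢n (below (m≤n⇒m≤1+n k<n))
                              (cong not (dec-false (k ℕ.≟ n) λ { refl → <-irrefl refl k<n }))

mexFrom-spec : ∀ f k l → (∀ {j} → j < k → j ∈ l) →
               (∀ {j} → j < mexFrom f k l → j ∈ l) × (mexFrom f k l ∉ l ⊎ mexFrom f k l ≡ k + f)
mexFrom-spec zero    k l below = below , inj₂ (sym (+-identityʳ k))
mexFrom-spec (suc f) k l below with member k l in k?
... | false = below , inj₁ (λ k∈l → true≢false (trans (sym (∈⇒member k∈l)) k?))
... | true  = Prod.map₂ (Data.Sum.map₂ (λ e → trans e (sym (+-suc k f))))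
                         (mexFrom-spec f (suc k) l below′)
  where
  below′ : ∀ {j} → j < suc k → j ∈ l
  below′ j<1+k with m≤n⇒m<n∨m≡n j<1+k
  ... | inj₁ (s≤s j<k) = below j<k
  ... | inj₂ refl      = member⇒∈ l k?

<mex⇒∈ : ∀ l {j} → j < mex l → j ∈ l
<mex⇒∈ l = proj₁ (mexFrom-spec (length l) 0 l (λ ()))

mex∉ : ∀ l → mex l ∉ l
mex∉ l mex∈l with mexFrom-spec (length l) 0 l (λ ())
... | _     , inj₁ mex∉l      = mex∉l mex∈l
... | below , inj₂ mex≡length = <-irrefl refl (all-below∈⇒≤length (suc (length l)) l below′)
  where
  -- running out of fuel would put all of 0, …, length l into l
  below′ : ∀ {k} → k < suc (length l) → k ∈ l
  below′ k<1+n with m≤n⇒m<n∨m≡n k<1+n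
  ... | inj₁ (s≤s k<n) = below (subst (_ <_) (sym mex≡length) k<n)
  ... | inj₂ refl      = subst (_∈ l) mex≡length mex∈l

mex-unchanged : ∀ l l′ → l′ ⊆ l → (∀ {v} → v ∈ l → v ∈ l′ ⊎ v ≢ mex l′) → mex l ≡ mex l′
mex-unchanged l l′ l′⊆l l⊆l′∪≢ with <-cmp (mex l) (mex l′)
... | tri≈ _ eq _ = eq
... | tri< lt _ _ = ⊥-elim (mex∉ l (l′⊆l (<mex⇒∈ l′ lt)))
... | tri> _ _ gt with l⊆l′∪≢ (<mex⇒∈ l gt)
...   | inj₁ mex∈l′ = ⊥-elim (mex∉ l′ mex∈l′)
...   | inj₂ mex≢   = ⊥-elim (mex≢ refl)

mapPElem : {A B : Set} → (A → B) → PElem A → PElem B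
mapPElem f ∅        = ∅
mapPElem f (vx u)   = vx (f u)
mapPElem f (ed a b) = ed (f a) (f b)

inInduced : {A : Set} → (A → Bool) → PElem A → Bool
inInduced p ∅        = true
inInduced p (vx u)   = p u
inInduced p (ed a b) = p a ∧ p b

module GraphPoset {W : Set} (_≟_ : DecidableEquality W) where

  _⊑ᵇ_ : PElem W → PElem W → Bool
  _⊑ᵇ_ = leqᵇ _≟_

  infix 4 _⊑_ _≃_

  data _⊑_ : PElem W → PElem W → Set where
    ∅⊑      : ∀ {y}   → ∅ ⊑ y
    vx⊑vx   : ∀ {u}   → vx u ⊑ vx u
    vx⊑ed₁  : ∀ {a b} → vx a ⊑ ed a b
    vx⊑ed₂  : ∀ {a b} → vx b ⊑ ed a b
    ed⊑ed   : ∀ {a b} → ed a b ⊑ ed a b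
    ed⊑swap : ∀ {a b} → ed a b ⊑ ed b a

  eqᵇ-refl : ∀ u → eqᵇ _≟_ u u ≡ true
  eqᵇ-refl u = dec-true (u ≟ u) refl

  eqᵇ⇒≡ : ∀ {u v} → eqᵇ _≟_ u v ≡ true → u ≡ v
  eqᵇ⇒≡ {u} {v} e with u ≟ v
  ... | yes u≡v = u≡v

  ⊑⇒⊑ᵇ : ∀ {x y} → x ⊑ y → x ⊑ᵇ y ≡ true
  ⊑⇒⊑ᵇ ∅⊑ = refl
  ⊑⇒⊑ᵇ (vx⊑vx {u}) = eqᵇ-refl u
  ⊑⇒⊑ᵇ (vx⊑ed₁ {a}) rewrite eqᵇ-refl a = refl
  ⊑⇒⊑ᵇ (vx⊑ed₂ {a} {b}) with b ≟ a
  ... | yes _ = refl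
  ... | no _  = eqᵇ-refl b
  ⊑⇒⊑ᵇ (ed⊑ed {a} {b}) rewrite eqᵇ-refl a | eqᵇ-refl b = refl
  ⊑⇒⊑ᵇ (ed⊑swap {a} {b}) with a ≟ b
  ... | yes refl rewrite eqᵇ-refl a = refl
  ... | no _     rewrite eqᵇ-refl a | eqᵇ-refl b = refl

  ⊑ᵇ⇒⊑ : ∀ x y → x ⊑ᵇ y ≡ true → x ⊑ y
  ⊑ᵇ⇒⊑ ∅ y _ = ∅⊑
  ⊑ᵇ⇒⊑ (vx u) (vx v) e with u ≟ v
  ... | yes refl = vx⊑vx
  ⊑ᵇ⇒⊑ (vx u) (ed a b) e with u ≟ a
  ... | yes refl = vx⊑ed₁
  ... | no _ with u ≟ b
  ...   | yes refl = vx⊑ed₂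
  ⊑ᵇ⇒⊑ (ed a b) (ed c c′) e with a ≟ c | b ≟ c′
  ... | yes refl | yes refl = ed⊑ed
  ... | yes refl | no _ with a ≟ c′ | b ≟ c
  ...   | yes refl | yes refl = ed⊑swap
  ⊑ᵇ⇒⊑ (ed a b) (ed c c′) e | no _ | _ with a ≟ c′ | b ≟ c
  ...   | yes refl | yes refl = ed⊑swap

  ⊑-trans : ∀ {x y z} → x ⊑ y → y ⊑ z → x ⊑ z
  ⊑-trans ∅⊑      _       = ∅⊑
  ⊑-trans vx⊑vx   y⊑z     = y⊑z
  ⊑-trans vx⊑ed₁  ed⊑ed   = vx⊑ed₁
  ⊑-trans vx⊑ed₁  ed⊑swap = vx⊑ed₂
  ⊑-trans vx⊑ed₂  ed⊑ed   = vx⊑ed₂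
  ⊑-trans vx⊑ed₂  ed⊑swap = vx⊑ed₁
  ⊑-trans ed⊑ed   y⊑z     = y⊑z
  ⊑-trans ed⊑swap ed⊑ed   = ed⊑swap
  ⊑-trans ed⊑swap ed⊑swap = ed⊑ed

  ⊑-vx⁻ : ∀ {u v} → vx u ⊑ vx v → u ≡ v
  ⊑-vx⁻ vx⊑vx = refl

  ⊑-ed⁻ : ∀ {a b c d} → ed a b ⊑ ed c d → (a ≡ c × b ≡ d) ⊎ (a ≡ d × b ≡ c)
  ⊑-ed⁻ ed⊑ed   = inj₁ (refl , refl)
  ⊑-ed⁻ ed⊑swap = inj₂ (refl , refl)

  inInduced-⊑ : ∀ p {x y} → x ⊑ y → inInduced p y ≡ true → inInduced p x ≡ true
  inInduced-⊑ p ∅⊑                  _ = refl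
  inInduced-⊑ p vx⊑vx               = id
  inInduced-⊑ p (vx⊑ed₁ {a} {b})    = ∧-conicalˡ (p a) (p b)
  inInduced-⊑ p (vx⊑ed₂ {a} {b})    = ∧-conicalʳ (p a) (p b)
  inInduced-⊑ p ed⊑ed               = id
  inInduced-⊑ p (ed⊑swap {a} {b})   = trans (∧-comm (p a) (p b))

  ⊑ᵇ-refl : ∀ x → x ⊑ᵇ x ≡ true
  ⊑ᵇ-refl ∅        = refl
  ⊑ᵇ-refl (vx u)   = ⊑⇒⊑ᵇ vx⊑vx
  ⊑ᵇ-refl (ed a b) = ⊑⇒⊑ᵇ ed⊑ed

  ⊑ᵇ-trans : ∀ x y z → x ⊑ᵇ y ≡ true → y ⊑ᵇ z ≡ true → x ⊑ᵇ z ≡ true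
  ⊑ᵇ-trans x y z x⊑y y⊑z = ⊑⇒⊑ᵇ (⊑-trans (⊑ᵇ⇒⊑ x y x⊑y) (⊑ᵇ⇒⊑ y z y⊑z))

  -- ed a b and ed b a are distinct terms denoting the same edge
  data _≃_ (x y : PElem W) : Set where
    mk≃ : x ⊑ᵇ y ≡ true → y ⊑ᵇ x ≡ true → x ≃ y

  ≃-refl : ∀ x → x ≃ x
  ≃-refl x = mk≃ (⊑ᵇ-refl x) (⊑ᵇ-refl x)

  ≃-sym : ∀ {x y} → x ≃ y → y ≃ x
  ≃-sym (mk≃ x⊑y y⊑x) = mk≃ y⊑x x⊑y

  ≡-by-implications : ∀ {b c} → (b ≡ true → c ≡ true) → (c ≡ true → b ≡ true) → b ≡ c
  ≡-by-implications {false} {false} _ _ = refl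
  ≡-by-implications {false} {true}  _ c⇒b = c⇒b refl
  ≡-by-implications {true}  {c}     b⇒c _ = sym (b⇒c refl)

  ⊑ᵇ-respʳ-≃ : ∀ {y y′} x → y ≃ y′ → x ⊑ᵇ y ≡ x ⊑ᵇ y′
  ⊑ᵇ-respʳ-≃ {y} {y′} x (mk≃ y⊑y′ y′⊑y) =
    ≡-by-implications (λ x⊑y → ⊑ᵇ-trans x y y′ x⊑y y⊑y′) (λ x⊑y′ → ⊑ᵇ-trans x y′ y x⊑y′ y′⊑y)

  ⊑ᵇ-respˡ-≃ : ∀ {x x′} z → x ≃ x′ → x ⊑ᵇ z ≡ x′ ⊑ᵇ z
  ⊑ᵇ-respˡ-≃ {x} {x′} z (mk≃ x⊑x′ x′⊑x) =
    ≡-by-implications (λ x⊑z → ⊑ᵇ-trans x′ x z x′⊑x x⊑z) (λ x′⊑z → ⊑ᵇ-trans x x′ z x⊑x′ x′⊑z)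

  isBot-resp-≃ : ∀ {x y} → x ≃ y → isBot x ≡ isBot y
  isBot-resp-≃ {∅}      {∅}      _       = refl
  isBot-resp-≃ {∅}      {vx _}   (mk≃ _ ())
  isBot-resp-≃ {∅}      {ed _ _} (mk≃ _ ())
  isBot-resp-≃ {vx _}   {∅}      (mk≃ () _)
  isBot-resp-≃ {vx _}   {vx _}   _       = refl
  isBot-resp-≃ {vx _}   {ed _ _} _       = refl
  isBot-resp-≃ {ed _ _} {∅}      (mk≃ () _)
  isBot-resp-≃ {ed _ _} {vx _}   _       = refl
  isBot-resp-≃ {ed _ _} {ed _ _} _       = refl

module Chomp {W : Set} (_≟_ : DecidableEquality W) where

  open GraphPoset _≟_

  chomp : PElem W → List (PElem W) → List (PElem W)
  chomp x Q = filterᵇ (λ y → not (x ⊑ᵇ y)) Q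

  moves : List (PElem W) → List (PElem W)
  moves Q = filterᵇ (not ∘ isBot) Q

  nim : List (PElem W) → ℕ
  nim Q = nimP _≟_ (suc (length Q)) Q

  options : List (PElem W) → List ℕ
  options Q = map (λ x → nim (chomp x Q)) (moves Q)

  ∈-chomp⁻ : ∀ x Q {z} → z ∈ chomp x Q → z ∈ Q × x ⊑ᵇ z ≡ false
  ∈-chomp⁻ x Q z∈ = Prod.map₂ not-injective (∈-filterᵇ⁻ _ z∈)

  ∈-chomp⁺ : ∀ x {Q z} → z ∈ Q → x ⊑ᵇ z ≡ false → z ∈ chomp x Q
  ∈-chomp⁺ x z∈Q x⋢z = ∈-filterᵇ⁺ _ z∈Q (cong not x⋢z)

  length-chomp-< : ∀ {x Q} → x ∈ Q → length (chomp x Q) < length Q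
  length-chomp-< {x} x∈Q = length-filterᵇ-< _ x∈Q (cong not (⊑ᵇ-refl x))

  chomp-idem : ∀ x Q → chomp x (chomp x Q) ≡ chomp x Q
  chomp-idem x = filter-idem (T? ∘ λ y → not (x ⊑ᵇ y))

  chomp-resp-≃ : ∀ {x x′} → x ≃ x′ → ∀ Q → chomp x Q ≡ chomp x′ Q
  chomp-resp-≃ {x} {x′} x≃x′ = filterᵇ-cong (λ y → not (x ⊑ᵇ y)) (λ z → cong not (⊑ᵇ-respˡ-≃ z x≃x′))

  ∈-moves⁻ : ∀ {Q x} → x ∈ moves Q → x ∈ Q
  ∈-moves⁻ = proj₁ ∘ ∈-filterᵇ⁻ (not ∘ isBot)

  ∈-moves⁺ : ∀ {Q x} → x ∈ Q → not (isBot x) ≡ true → x ∈ moves Q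
  ∈-moves⁺ = ∈-filterᵇ⁺ (not ∘ isBot)

  chomp-move-< : ∀ Q {x} → x ∈ moves Q → length (chomp x Q) < length Q
  chomp-move-< Q x∈ = length-chomp-< {Q = Q} (∈-moves⁻ {Q} x∈)

  nimP-fuel : ∀ f f′ Q → length Q < f → length Q < f′ → nimP _≟_ f Q ≡ nimP _≟_ f′ Q
  nimP-fuel (suc f) (suc f′) Q (s≤s Q≤f) (s≤s Q≤f′) =
    cong mex (map-cong-local (All.tabulate λ {x} x∈ →
      let shrinks = chomp-move-< Q x∈ in
      nimP-fuel f f′ (chomp x Q) (<-≤-trans shrinks Q≤f) (<-≤-trans shrinks Q≤f′)))

  nim-unfold : ∀ Q → nim Q ≡ mex (options Q)
  nim-unfold Q = cong mex (map-cong-local (All.tabulate λ {x} x∈ →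
    nimP-fuel (length Q) _ (chomp x Q) (chomp-move-< Q x∈) (n<1+n _)))

  module Symmetry
    (Good  : PElem W → Set)
    (σ     : PElem W → PElem W)
    (fixed : PElem W → Bool)
    (σ-good         : ∀ {x} → Good x → Good (σ x))
    (σ-involutive   : ∀ {x} → Good x → σ (σ x) ≡ x)
    (σ-⊑ᵇ           : ∀ {x y} → Good x → Good y → σ x ⊑ᵇ σ y ≡ x ⊑ᵇ y)
    (σ-isBot        : ∀ x → isBot (σ x) ≡ isBot x)
    (fixed⇒σ≡       : ∀ {x} → Good x → fixed x ≡ true → σ x ≡ x)
    (unfixed-⋢σ     : ∀ {x} → Good x → fixed x ≡ false → x ⊑ᵇ σ x ≡ false)
    (unfixed-⋢fixed : ∀ {x y} → Good x → Good y → fixed x ≡ false → fixed y ≡ true → x ⊑ᵇ y ≡ false)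
    where

    AllGood : List (PElem W) → Set
    AllGood Q = ∀ {x} → x ∈ Q → Good x

    σ-Closed : List (PElem W) → Set
    σ-Closed Q = ∀ {x} → x ∈ Q → Σ (PElem W) λ y → y ∈ Q × y ≃ σ x

    fixedPart : List (PElem W) → List (PElem W)
    fixedPart = filterᵇ fixed

    AllGood-chomp : ∀ x {Q} → AllGood Q → AllGood (chomp x Q)
    AllGood-chomp x {Q} good = good ∘ proj₁ ∘ ∈-chomp⁻ x Q

    fixed-σ : ∀ {x} → Good x → fixed (σ x) ≡ fixed x
    fixed-σ {x} g with fixed x in fx
    ... | true  = trans (cong fixed (fixed⇒σ≡ g fx)) fx
    ... | false = ¬-not λ fσx → true≢false (begin
        true          ≡⟨ sym (⊑ᵇ-refl x) ⟩
        x ⊑ᵇ x        ≡⟨ cong (x ⊑ᵇ_) (trans (sym (σ-involutive g)) (fixed⇒σ≡ (σ-good g) fσx)) ⟩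
        x ⊑ᵇ σ x      ≡⟨ unfixed-⋢σ g fx ⟩
        false         ∎)
      where open ≡-Reasoning

    ⊑ᵇ-σ-swap : ∀ {x z z′} → Good x → Good z → z′ ≃ σ z → x ⊑ᵇ z′ ≡ σ x ⊑ᵇ z
    ⊑ᵇ-σ-swap {x} {z} {z′} gx gz z′≃σz = begin
      x ⊑ᵇ z′           ≡⟨ ⊑ᵇ-respʳ-≃ x z′≃σz ⟩
      x ⊑ᵇ σ z          ≡⟨ cong (_⊑ᵇ σ z) (sym (σ-involutive gx)) ⟩
      σ (σ x) ⊑ᵇ σ z    ≡⟨ σ-⊑ᵇ (σ-good gx) gz ⟩
      σ x ⊑ᵇ z          ∎
      where open ≡-Reasoning

    chomp-pair-σ-Closed : ∀ {x y Q} → AllGood Q → σ-Closed Q → Good x → y ≃ σ x →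
                          σ-Closed (chomp y (chomp x Q))
    chomp-pair-σ-Closed {x} {y} {Q} good closed gx y≃σx {z} z∈ with ∈-chomp⁻ y (chomp x Q) z∈
    ... | z∈Qx , y⋢z with ∈-chomp⁻ x Q z∈Qx
    ... | z∈Q , x⋢z with closed z∈Q
    ... | z′ , z′∈Q , z′≃σz = z′ , ∈-chomp⁺ y (∈-chomp⁺ x z′∈Q x⋢z′) y⋢z′ , z′≃σz
      where
      open ≡-Reasoning
      gz = good z∈Q
      x⋢z′ : x ⊑ᵇ z′ ≡ false
      x⋢z′ = begin
        x ⊑ᵇ z′      ≡⟨ ⊑ᵇ-σ-swap gx gz z′≃σz ⟩
        σ x ⊑ᵇ z     ≡⟨ ⊑ᵇ-respˡ-≃ z (≃-sym y≃σx) ⟩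
        y ⊑ᵇ z       ≡⟨ y⋢z ⟩
        false        ∎
      y⋢z′ : y ⊑ᵇ z′ ≡ false
      y⋢z′ = begin
        y ⊑ᵇ z′          ≡⟨ ⊑ᵇ-respˡ-≃ z′ y≃σx ⟩
        σ x ⊑ᵇ z′        ≡⟨ ⊑ᵇ-σ-swap (σ-good gx) gz z′≃σz ⟩
        σ (σ x) ⊑ᵇ z     ≡⟨ cong (_⊑ᵇ z) (σ-involutive gx) ⟩
        x ⊑ᵇ z           ≡⟨ x⋢z ⟩
        false            ∎

    chomp-fixed-σ-Closed : ∀ {x Q} → AllGood Q → σ-Closed Q → Good x → fixed x ≡ true →
                           σ-Closed (chomp x Q)
    chomp-fixed-σ-Closed {x} {Q} good closed gx fx =
      subst σ-Closed (chomp-idem x Q)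
            (chomp-pair-σ-Closed good closed gx (subst (x ≃_) (sym (fixed⇒σ≡ gx fx)) (≃-refl x)))

    fixedPart-chomp : ∀ x Q → fixedPart (chomp x Q) ≡ chomp x (fixedPart Q)
    fixedPart-chomp x = filterᵇ-comm fixed _

    chomp-unfixed-fixedPart : ∀ {x Q} → AllGood Q → Good x → fixed x ≡ false →
                              chomp x (fixedPart Q) ≡ fixedPart Q
    chomp-unfixed-fixedPart {x} good gx fx = filterᵇ-all (λ y → not (x ⊑ᵇ y)) λ z∈R →
      let z∈Q , fz = ∈-filterᵇ⁻ fixed z∈R in cong not (unfixed-⋢fixed gx (good z∈Q) fx fz)

    chomp-pair-fixedPart : ∀ {x y Q} → AllGood Q → Good x → fixed x ≡ false → y ≃ σ x →
                           fixedPart (chomp y (chomp x Q)) ≡ fixedPart Q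
    chomp-pair-fixedPart {x} {y} {Q} good gx fx y≃σx = begin
      fixedPart (chomp y (chomp x Q))  ≡⟨ fixedPart-chomp y (chomp x Q) ⟩
      chomp y (fixedPart (chomp x Q))  ≡⟨ cong (chomp y) (fixedPart-chomp x Q) ⟩
      chomp y (chomp x (fixedPart Q))  ≡⟨ cong (chomp y) (chomp-unfixed-fixedPart good gx fx) ⟩
      chomp y (fixedPart Q)            ≡⟨ chomp-resp-≃ y≃σx (fixedPart Q) ⟩
      chomp (σ x) (fixedPart Q)        ≡⟨ chomp-unfixed-fixedPart good (σ-good gx) (trans (fixed-σ gx) fx) ⟩
      fixedPart Q                      ∎
      where open ≡-Reasoning

    σ-partner-move : ∀ {x Q} → AllGood Q → σ-Closed Q → x ∈ moves Q → fixed x ≡ false →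
                     Σ (PElem W) λ y → y ∈ moves (chomp x Q) × y ≃ σ x
    σ-partner-move {x} {Q} good closed x∈ fx with ∈-filterᵇ⁻ (not ∘ isBot) x∈
    ... | x∈Q , x≢⊥ with closed x∈Q
    ... | y , y∈Q , y≃σx = y , ∈-moves⁺ (∈-chomp⁺ x y∈Q x⋢y) y≢⊥ , y≃σx
      where
      x⋢y : x ⊑ᵇ y ≡ false
      x⋢y = trans (⊑ᵇ-respʳ-≃ x y≃σx) (unfixed-⋢σ (good x∈Q) fx)
      y≢⊥ : not (isBot y) ≡ true
      y≢⊥ = trans (cong not (trans (isBot-resp-≃ y≃σx) (σ-isBot x))) x≢⊥

    NimOfFixedPart : List (PElem W) → Set
    NimOfFixedPart Q = AllGood Q → σ-Closed Q → nim Q ≡ nim (fixedPart Q)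

    HoldsBelow : List (PElem W) → Set
    HoldsBelow Q = ∀ Q′ → length Q′ < length Q → NimOfFixedPart Q′

    nim-chomp-fixed : ∀ {x Q} → HoldsBelow Q → AllGood Q → σ-Closed Q → x ∈ Q → fixed x ≡ true →
                      nim (chomp x Q) ≡ nim (chomp x (fixedPart Q))
    nim-chomp-fixed {x} {Q} IH good closed x∈Q fx =
      trans (IH (chomp x Q) (length-chomp-< x∈Q) (AllGood-chomp x good)
                (chomp-fixed-σ-Closed good closed (good x∈Q) fx))
            (cong nim (fixedPart-chomp x Q))

    nim-chomp-unfixed : ∀ {x Q} → HoldsBelow Q → AllGood Q → σ-Closed Q → x ∈ moves Q → fixed x ≡ false →
                        nim (chomp x Q) ≢ nim (fixedPart Q)
    nim-chomp-unfixed {x} {Q} IH good closed x∈ fx nimQx≡nimR with σ-partner-move good closed x∈ fx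
    ... | y , y∈ , y≃σx = mex∉ (options Qx) (subst (_∈ options Qx) nimQxy≡mex (∈-map⁺ _ y∈))
      where
      open ≡-Reasoning
      Qx = chomp x Q
      Qxy = chomp y Qx
      gx = good (∈-moves⁻ x∈)
      nimQxy≡mex : nim Qxy ≡ mex (options Qx)
      nimQxy≡mex = begin
        nim Qxy              ≡⟨ IH Qxy (<-trans (chomp-move-< Qx y∈) (chomp-move-< Q x∈))
                                   (AllGood-chomp y (AllGood-chomp x good))
                                   (chomp-pair-σ-Closed good closed gx y≃σx) ⟩
        nim (fixedPart Qxy)  ≡⟨ cong nim (chomp-pair-fixedPart good gx fx y≃σx) ⟩
        nim (fixedPart Q)    ≡⟨ sym nimQx≡nimR ⟩
        nim Qx               ≡⟨ nim-unfold Qx ⟩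
        mex (options Qx)     ∎

    nim-fixedPart-step : ∀ Q → HoldsBelow Q → NimOfFixedPart Q
    nim-fixedPart-step Q IH good closed = begin
      nim Q            ≡⟨ nim-unfold Q ⟩
      mex (options Q)  ≡⟨ mex-unchanged (options Q) (options R) fixed-options⊆ unfixed-options ⟩
      mex (options R)  ≡⟨ sym (nim-unfold R) ⟩
      nim R            ∎
      where
      open ≡-Reasoning
      R = fixedPart Q

      fixed-options⊆ : options R ⊆ options Q
      fixed-options⊆ v∈ with ∈-map⁻ _ v∈
      ... | x , x∈ , refl with ∈-filterᵇ⁻ (not ∘ isBot) x∈
      ... | x∈R , x≢⊥ with ∈-filterᵇ⁻ fixed x∈R
      ... | x∈Q , fx = subst (_∈ options Q) (nim-chomp-fixed IH good closed x∈Q fx)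
                             (∈-map⁺ _ (∈-moves⁺ x∈Q x≢⊥))

      unfixed-options : ∀ {v} → v ∈ options Q → v ∈ options R ⊎ v ≢ mex (options R)
      unfixed-options v∈ with ∈-map⁻ _ v∈
      ... | x , x∈ , refl with ∈-filterᵇ⁻ (not ∘ isBot) x∈ | fixed x in fx
      ... | x∈Q , x≢⊥ | true  = inj₁ (subst (_∈ options R) (sym (nim-chomp-fixed IH good closed x∈Q fx))
                                      (∈-map⁺ _ (∈-moves⁺ (∈-filterᵇ⁺ fixed x∈Q fx) x≢⊥)))
      ... | _         | false =
        inj₂ λ v≡mex → nim-chomp-unfixed IH good closed x∈ fx (trans v≡mex (sym (nim-unfold R)))

    nim-fixedPart : ∀ Q → NimOfFixedPart Q
    nim-fixedPart Q = bounded (suc (length Q)) Q (n<1+n _)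
      where
      bounded : ∀ n Q → length Q < n → NimOfFixedPart Q
      bounded (suc n) Q (s≤s Q≤n) =
        nim-fixedPart-step Q λ Q′ Q′<Q → bounded n Q′ (<-≤-trans Q′<Q Q≤n)

IsElem : (G : Graph) → PElem (V G) → Set
IsElem G ∅        = ⊤
IsElem G (vx u)   = u ∈ verts G
IsElem G (ed a b) = a ∈ verts G × b ∈ verts G × adj G a b ≡ true

module ElemsOf (G : Graph) where

  open GraphPoset (decEq G)

  private
    edge : V G × V G → PElem (V G)
    edge q = ed (proj₁ q) (proj₂ q)

    adjacent : V G × V G → Bool
    adjacent q = adj G (proj₁ q) (proj₂ q)

  ∈-elems⁻ : ∀ {x} → x ∈ elems G → IsElem G x
  ∈-elems⁻ (here refl) = tt
  ∈-elems⁻ (there x∈) with ∈-++⁻ (map vx (verts G)) x∈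
  ... | inj₁ x∈vs with ∈-map⁻ vx x∈vs
  ...   | _ , u∈ , refl = u∈
  ∈-elems⁻ (there x∈) | inj₂ x∈es with ∈-map⁻ edge x∈es
  ...   | _ , ab∈ , refl = let ab∈pairs , a~b = ∈-filterᵇ⁻ adjacent ab∈ in
                           Prod.map₂ (_, a~b) (∈-pairs⁻ (verts G) ab∈pairs)

  ed∈elems : ∀ {a b} → (a , b) ∈ pairs (verts G) → adj G a b ≡ true → ed a b ∈ elems G
  ed∈elems ab∈ a~b = there (∈-++⁺ʳ (map vx (verts G)) (∈-map⁺ edge (∈-filterᵇ⁺ adjacent ab∈ a~b)))

  ∃≃∈elems : ∀ {x} → IsElem G x → Σ (PElem (V G)) λ y → y ∈ elems G × y ≃ x
  ∃≃∈elems {∅} _ = ∅ , here refl , ≃-refl ∅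
  ∃≃∈elems {vx u} u∈ = vx u , there (∈-++⁺ˡ (∈-map⁺ vx u∈)) , ≃-refl (vx u)
  ∃≃∈elems {ed a b} (a∈ , b∈ , a~b) with ∈-pairs⁺ (verts G) a∈ b∈ a≢b
    where
    a≢b : a ≢ b
    a≢b refl with () ← trans (sym a~b) (adj-irr G a)
  ... | inj₁ ab∈ = ed a b , ed∈elems ab∈ a~b , ≃-refl (ed a b)
  ... | inj₂ ba∈ = ed b a , ed∈elems ba∈ (trans (adj-sym G b a) a~b) ,
                   mk≃ (⊑⇒⊑ᵇ ed⊑swap) (⊑⇒⊑ᵇ ed⊑swap)

  filterᵇ-elems-induced : ∀ p → filterᵇ (inInduced p) (elems G) ≡ elems (induced G p)
  filterᵇ-elems-induced p = cong (∅ ∷_) (begin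
    filterᵇ (inInduced p) (map vx (verts G) ++ map edge (edges G))
      ≡⟨ filterᵇ-++ (inInduced p) (map vx (verts G)) (map edge (edges G)) ⟩
    filterᵇ (inInduced p) (map vx (verts G)) ++ filterᵇ (inInduced p) (map edge (edges G))
      ≡⟨ cong₂ _++_ (filterᵇ-map (inInduced p) vx (verts G)) (filterᵇ-map (inInduced p) edge (edges G)) ⟩
    map vx (filterᵇ p (verts G)) ++ map edge (filterᵇ both (filterᵇ adjacent (pairs (verts G))))
      ≡⟨ cong (λ es → map vx (filterᵇ p (verts G)) ++ map edge es) induced-edges ⟩
    map vx (filterᵇ p (verts G)) ++ map edge (edges (induced G p))
      ∎)
    where
    open ≡-Reasoning
    both : V G × V G → Bool
    both q = p (proj₁ q) ∧ p (proj₂ q)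
    induced-edges : filterᵇ both (filterᵇ adjacent (pairs (verts G))) ≡ edges (induced G p)
    induced-edges = trans (filterᵇ-comm both adjacent (pairs (verts G)))
                          (cong (filterᵇ adjacent) (sym (pairs-filterᵇ p (verts G))))

module InvolutiveAutomorphism (G : Graph) (φ : V G → V G) (aut : IsAutomorphism G φ)
  (φ-involutive  : ∀ u → u ∈ verts G → φ (φ u) ≡ u)
  (φ-nonadjacent : ∀ u → u ∈ verts G → adj G u (φ u) ≡ false)
  where

  open IsAutomorphism aut
  open GraphPoset (decEq G)
  open Chomp (decEq G)

  isFixed : V G → Bool
  isFixed u = eqᵇ (decEq G) (φ u) u

  fixedElem : PElem (V G) → Bool
  fixedElem = inInduced isFixed

  σ : PElem (V G) → PElem (V G)
  σ = mapPElem φ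

  σ-IsElem : ∀ {x} → IsElem G x → IsElem G (σ x)
  σ-IsElem {∅}      _                 = tt
  σ-IsElem {vx u}   u∈                = maps-into u u∈
  σ-IsElem {ed a b} (a∈ , b∈ , a~b) = maps-into a a∈ , maps-into b b∈ , trans (preserves a b a∈ b∈) a~b

  σ-involutive : ∀ {x} → IsElem G x → σ (σ x) ≡ x
  σ-involutive {∅}      _             = refl
  σ-involutive {vx u}   u∈            = cong vx (φ-involutive u u∈)
  σ-involutive {ed a b} (a∈ , b∈ , _) = cong₂ ed (φ-involutive a a∈) (φ-involutive b b∈)

  eqᵇ-φ : ∀ {u v} → u ∈ verts G → v ∈ verts G → eqᵇ (decEq G) (φ u) (φ v) ≡ eqᵇ (decEq G) u v
  eqᵇ-φ {u} {v} u∈ v∈ with decEq G u v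
  ... | yes refl = eqᵇ-refl (φ u)
  ... | no u≢v   = dec-false (decEq G (φ u) (φ v)) (u≢v ∘ injective u v u∈ v∈)

  σ-⊑ᵇ : ∀ {x y} → IsElem G x → IsElem G y → σ x ⊑ᵇ σ y ≡ x ⊑ᵇ y
  σ-⊑ᵇ {∅}                 _  _  = refl
  σ-⊑ᵇ {vx _}   {∅}        _  _  = refl
  σ-⊑ᵇ {vx _}   {vx _}     u∈ v∈ = eqᵇ-φ u∈ v∈
  σ-⊑ᵇ {vx _}   {ed _ _}   u∈ (a∈ , b∈ , _) = cong₂ _∨_ (eqᵇ-φ u∈ a∈) (eqᵇ-φ u∈ b∈)
  σ-⊑ᵇ {ed _ _} {∅}        _  _  = refl
  σ-⊑ᵇ {ed _ _} {vx _}     _  _  = refl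
  σ-⊑ᵇ {ed _ _} {ed _ _} (a∈ , b∈ , _) (c∈ , d∈ , _) =
    cong₂ _∨_ (cong₂ _∧_ (eqᵇ-φ a∈ c∈) (eqᵇ-φ b∈ d∈)) (cong₂ _∧_ (eqᵇ-φ a∈ d∈) (eqᵇ-φ b∈ c∈))

  σ-isBot : ∀ x → isBot (σ x) ≡ isBot x
  σ-isBot ∅        = refl
  σ-isBot (vx _)   = refl
  σ-isBot (ed _ _) = refl

  fixed⇒σ≡ : ∀ {x} → IsElem G x → fixedElem x ≡ true → σ x ≡ x
  fixed⇒σ≡ {∅}      _ _ = refl
  fixed⇒σ≡ {vx u}   _ u-fixed = cong vx (eqᵇ⇒≡ u-fixed)
  fixed⇒σ≡ {ed a b} _ ab-fixed =
    cong₂ ed (eqᵇ⇒≡ (∧-conicalˡ _ _ ab-fixed)) (eqᵇ⇒≡ (∧-conicalʳ _ _ ab-fixed))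

  isFixed-≡ : ∀ {u} → φ u ≡ u → isFixed u ≡ true
  isFixed-≡ {u} = dec-true (decEq G (φ u) u)

  unfixed-⋢σ : ∀ {x} → IsElem G x → fixedElem x ≡ false → x ⊑ᵇ σ x ≡ false
  unfixed-⋢σ {x} x∈ x-unfixed = ¬-not λ x⊑σx → ⋢ x∈ x-unfixed (⊑ᵇ⇒⊑ x (σ x) x⊑σx)
    where
    ⋢ : ∀ {x} → IsElem G x → fixedElem x ≡ false → ¬ x ⊑ σ x
    ⋢ {vx u} _ u-unfixed u⊑φu
      with () ← trans (sym (isFixed-≡ (sym (⊑-vx⁻ u⊑φu)))) u-unfixed
    ⋢ {ed a b} (a∈ , _ , a~b) ab-unfixed ab⊑φaφb with ⊑-ed⁻ ab⊑φaφb
    ... | inj₁ (a≡φa , b≡φb)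
      with () ← trans (sym (cong₂ _∧_ (isFixed-≡ (sym a≡φa)) (isFixed-≡ (sym b≡φb)))) ab-unfixed
    ... | inj₂ (_ , b≡φa)
      with () ← trans (sym a~b) (trans (cong (adj G a) b≡φa) (φ-nonadjacent a a∈))

  unfixed-⋢fixed : ∀ {x y} → IsElem G x → IsElem G y → fixedElem x ≡ false → fixedElem y ≡ true →
                   x ⊑ᵇ y ≡ false
  unfixed-⋢fixed {x} {y} _ _ x-unfixed y-fixed = ¬-not λ x⊑y →
    true≢false (trans (sym (inInduced-⊑ isFixed (⊑ᵇ⇒⊑ x y x⊑y) y-fixed)) x-unfixed)

  open ElemsOf G
  open Symmetry (IsElem G) σ fixedElem
                σ-IsElem σ-involutive σ-⊑ᵇ σ-isBot fixed⇒σ≡ unfixed-⋢σ unfixed-⋢fixed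

  Nim≡Nim-fixedSubgraph : Nim G ≡ Nim (fixedSubgraph G φ)
  Nim≡Nim-fixedSubgraph = begin
    nim (elems G)                   ≡⟨ nim-fixedPart (elems G) ∈-elems⁻ elems-σ-Closed ⟩
    nim (fixedPart (elems G))       ≡⟨ cong nim (filterᵇ-elems-induced isFixed) ⟩
    nim (elems (fixedSubgraph G φ)) ∎
    where
    open ≡-Reasoning
    elems-σ-Closed : σ-Closed (elems G)
    elems-σ-Closed x∈ = ∃≃∈elems (σ-IsElem (∈-elems⁻ x∈))

Nim-fixedSubgraph : (G : Graph) (φ : V G → V G) → IsAutomorphism G φ →
                    (∀ u → u ∈ verts G → φ (φ u) ≡ u) →
                    (∀ u → u ∈ verts G → adj G u (φ u) ≡ false) →
                    Nim G ≡ Nim (fixedSubgraph G φ)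
Nim-fixedSubgraph G φ aut φ-involutive φ-nonadjacent =
  InvolutiveAutomorphism.Nim≡Nim-fixedSubgraph G φ aut φ-involutive φ-nonadjacent

module JoinOfGraphs (G₁ G₂ : Graph) where

  ∈-+ᴳ-inj₁⁻ : ∀ {a} → inj₁ a ∈ verts (G₁ +ᴳ G₂) → a ∈ verts G₁
  ∈-+ᴳ-inj₁⁻ a∈ with ∈-++⁻ (map inj₁ (verts G₁)) a∈
  ... | inj₁ a∈₁ with ∈-map⁻ inj₁ a∈₁
  ...   | _ , a∈′ , refl = a∈′
  ∈-+ᴳ-inj₁⁻ a∈ | inj₂ a∈₂ with ∈-map⁻ inj₂ a∈₂
  ...   | _ , _ , ()

  ∈-+ᴳ-inj₂⁻ : ∀ {a} → inj₂ a ∈ verts (G₁ +ᴳ G₂) → a ∈ verts G₂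
  ∈-+ᴳ-inj₂⁻ a∈ with ∈-++⁻ (map inj₁ (verts G₁)) a∈
  ... | inj₁ a∈₁ with ∈-map⁻ inj₁ a∈₁
  ...   | _ , _ , ()
  ∈-+ᴳ-inj₂⁻ a∈ | inj₂ a∈₂ with ∈-map⁻ inj₂ a∈₂
  ...   | _ , a∈′ , refl = a∈′

  ∈-+ᴳ-inj₁⁺ : ∀ {a} → a ∈ verts G₁ → inj₁ a ∈ verts (G₁ +ᴳ G₂)
  ∈-+ᴳ-inj₁⁺ a∈ = ∈-++⁺ˡ (∈-map⁺ inj₁ a∈)

  ∈-+ᴳ-inj₂⁺ : ∀ {a} → a ∈ verts G₂ → inj₂ a ∈ verts (G₁ +ᴳ G₂)
  ∈-+ᴳ-inj₂⁺ a∈ = ∈-++⁺ʳ (map inj₁ (verts G₁)) (∈-map⁺ inj₂ a∈)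

module JoinOfAutomorphisms (G₁ G₂ : Graph) (φ₁ : V G₁ → V G₁) (φ₂ : V G₂ → V G₂) where

  open JoinOfGraphs G₁ G₂

  private
    φ : V G₁ ⊎ V G₂ → V G₁ ⊎ V G₂
    φ = Data.Sum.map φ₁ φ₂

  +ᴳ-automorphism : IsAutomorphism G₁ φ₁ → IsAutomorphism G₂ φ₂ → IsAutomorphism (G₁ +ᴳ G₂) φ
  +ᴳ-automorphism aut₁ aut₂ = record
    { maps-into  = maps-into
    ; injective  = injective
    ; surjective = surjective
    ; preserves  = preserves
    }
    where
    module A₁ = IsAutomorphism aut₁
    module A₂ = IsAutomorphism aut₂

    maps-into : ∀ u → u ∈ verts (G₁ +ᴳ G₂) → φ u ∈ verts (G₁ +ᴳ G₂)
    maps-into (inj₁ a) a∈ = ∈-+ᴳ-inj₁⁺ (A₁.maps-into a (∈-+ᴳ-inj₁⁻ a∈))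
    maps-into (inj₂ a) a∈ = ∈-+ᴳ-inj₂⁺ (A₂.maps-into a (∈-+ᴳ-inj₂⁻ a∈))

    injective : ∀ u v → u ∈ verts (G₁ +ᴳ G₂) → v ∈ verts (G₁ +ᴳ G₂) → φ u ≡ φ v → u ≡ v
    injective (inj₁ a) (inj₁ b) a∈ b∈ e =
      cong inj₁ (A₁.injective a b (∈-+ᴳ-inj₁⁻ a∈) (∈-+ᴳ-inj₁⁻ b∈) (inj₁-injective e))
    injective (inj₂ a) (inj₂ b) a∈ b∈ e =
      cong inj₂ (A₂.injective a b (∈-+ᴳ-inj₂⁻ a∈) (∈-+ᴳ-inj₂⁻ b∈) (inj₂-injective e))

    surjective : ∀ v → v ∈ verts (G₁ +ᴳ G₂) → Σ (V G₁ ⊎ V G₂) λ u → u ∈ verts (G₁ +ᴳ G₂) × φ u ≡ v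
    surjective (inj₁ b) b∈ with A₁.surjective b (∈-+ᴳ-inj₁⁻ b∈)
    ... | a , a∈ , refl = inj₁ a , ∈-+ᴳ-inj₁⁺ a∈ , refl
    surjective (inj₂ b) b∈ with A₂.surjective b (∈-+ᴳ-inj₂⁻ b∈)
    ... | a , a∈ , refl = inj₂ a , ∈-+ᴳ-inj₂⁺ a∈ , refl

    preserves : ∀ u v → u ∈ verts (G₁ +ᴳ G₂) → v ∈ verts (G₁ +ᴳ G₂) →
                adj (G₁ +ᴳ G₂) (φ u) (φ v) ≡ adj (G₁ +ᴳ G₂) u v
    preserves (inj₁ a) (inj₁ b) a∈ b∈ = A₁.preserves a b (∈-+ᴳ-inj₁⁻ a∈) (∈-+ᴳ-inj₁⁻ b∈)
    preserves (inj₁ _) (inj₂ _) _  _  = refl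
    preserves (inj₂ _) (inj₁ _) _  _  = refl
    preserves (inj₂ a) (inj₂ b) a∈ b∈ = A₂.preserves a b (∈-+ᴳ-inj₂⁻ a∈) (∈-+ᴳ-inj₂⁻ b∈)

  +ᴳ-involutive : (∀ u → u ∈ verts G₁ → φ₁ (φ₁ u) ≡ u) → (∀ u → u ∈ verts G₂ → φ₂ (φ₂ u) ≡ u) →
                  ∀ u → u ∈ verts (G₁ +ᴳ G₂) → φ (φ u) ≡ u
  +ᴳ-involutive inv₁ _ (inj₁ a) a∈ = cong inj₁ (inv₁ a (∈-+ᴳ-inj₁⁻ a∈))
  +ᴳ-involutive _ inv₂ (inj₂ a) a∈ = cong inj₂ (inv₂ a (∈-+ᴳ-inj₂⁻ a∈))

  +ᴳ-nonadjacent : (∀ u → u ∈ verts G₁ → adj G₁ u (φ₁ u) ≡ false) →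
                   (∀ u → u ∈ verts G₂ → adj G₂ u (φ₂ u) ≡ false) →
                   ∀ u → u ∈ verts (G₁ +ᴳ G₂) → adj (G₁ +ᴳ G₂) u (φ u) ≡ false
  +ᴳ-nonadjacent na₁ _ (inj₁ a) a∈ = na₁ a (∈-+ᴳ-inj₁⁻ a∈)
  +ᴳ-nonadjacent _ na₂ (inj₂ a) a∈ = na₂ a (∈-+ᴳ-inj₂⁻ a∈)

  -- both graphs share vertex type, decidable equality and adjacency; only their vertex lists differ
  Nim-fixedSubgraph-+ᴳ : Nim (fixedSubgraph (G₁ +ᴳ G₂) φ) ≡ Nim (fixedSubgraph G₁ φ₁ +ᴳ fixedSubgraph G₂ φ₂)
  Nim-fixedSubgraph-+ᴳ = cong (λ vs → nim (elemsOn vs)) fixed-verts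
    where
    open Chomp (decEq (G₁ +ᴳ G₂))
    G = G₁ +ᴳ G₂
    isFixed : V G → Bool
    isFixed u = eqᵇ (decEq G) (φ u) u
    fixed-verts : filterᵇ isFixed (verts G) ≡ verts (fixedSubgraph G₁ φ₁ +ᴳ fixedSubgraph G₂ φ₂)
    fixed-verts = trans (filterᵇ-++ isFixed (map inj₁ (verts G₁)) (map inj₂ (verts G₂)))
                        (cong₂ _++_ (filterᵇ-map isFixed inj₁ (verts G₁)) (filterᵇ-map isFixed inj₂ (verts G₂)))
    elemsOn : List (V G) → List (PElem (V G))
    elemsOn vs = ∅ ∷ (map vx vs ++ map (λ q → ed (proj₁ q) (proj₂ q))
                                          (filterᵇ (λ q → adj G (proj₁ q) (proj₂ q)) (pairs vs)))

corollary2p6 : (G₁ G₂ : Graph)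
    → (φ₁ : V G₁ → V G₁) → (φ₂ : V G₂ → V G₂)
    → IsAutomorphism G₁ φ₁ → IsAutomorphism G₂ φ₂
    → (∀ u → u ∈ verts G₁ → φ₁ (φ₁ u) ≡ u)
    → (∀ u → u ∈ verts G₂ → φ₂ (φ₂ u) ≡ u)
    → (∀ u → u ∈ verts G₁ → adj G₁ u (φ₁ u) ≡ false)
    → (∀ u → u ∈ verts G₂ → adj G₂ u (φ₂ u) ≡ false)
    → Nim (G₁ +ᴳ G₂) ≡ Nim (fixedSubgraph G₁ φ₁ +ᴳ fixedSubgraph G₂ φ₂)
corollary2p6 G₁ G₂ φ₁ φ₂ aut₁ aut₂ inv₁ inv₂ na₁ na₂ = begin
  Nim (G₁ +ᴳ G₂)
    ≡⟨ Nim-fixedSubgraph (G₁ +ᴳ G₂) (Data.Sum.map φ₁ φ₂)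
         (+ᴳ-automorphism aut₁ aut₂) (+ᴳ-involutive inv₁ inv₂) (+ᴳ-nonadjacent na₁ na₂) ⟩
  Nim (fixedSubgraph (G₁ +ᴳ G₂) (Data.Sum.map φ₁ φ₂))
    ≡⟨ Nim-fixedSubgraph-+ᴳ ⟩
  Nim (fixedSubgraph G₁ φ₁ +ᴳ fixedSubgraph G₂ φ₂)
    ∎
  where
  open ≡-Reasoning
  open JoinOfAutomorphisms G₁ G₂ φ₁ φ₂
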